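{- Let $u^{(1)},\dots,u^{(n)}\in\mathbb{Z}^d$ and let $\Gamma=\{L_{u^{(1)}},\dots,L_{u^{(n)}}\}$. Then the Plesken–Zassenhaus order $$\mathrm{PZ}(\Gamma)=\mathrm{End}_{\mathcal{O}_K}(L_{u^{(1)}})\cap\cdots\cap\mathrm{End}_{\mathcal{O}_K}(L_{u^{(n)}})$$ coincides with the lattice $\Lambda_M=\{X\in K^{d\times d}:\mathrm{val}(x_{ij})\ge m_{ij}\ \forall i,j\}$, where $$M=M(u^{(1)})\,\overline{\oplus}\,M(u^{(2)})\,\overline{\oplus}\,\cdots\,\overline{\oplus}\,M(u^{(n)}),$$ i.e.\ $m_{ij}=\max_{1\le k\le n}\big(u^{(k)}_i-u^{(k)}_j\big)$. Moreover, this matrix $M$ is min-plus idempotent: $m_{ij}+m_{jk}\ge m_{ik}$ for all $1\le i,j,k\le d$, and $M\,\underline{\odot}\,M=M$.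
   Context: $K$ is a field with a surjective discrete valuation $\mathrm{val}:K\to\mathbb{Z}\cup\{\infty\}$, $p\in K$ with $\mathrm{val}(p)=1$, $\mathcal{O}_K$ its valuation ring. For $u\in\mathbb{Z}^d$, $L_u=\mathrm{diag}(p^{u_1},\dots,p^{u_d})\,\mathcal{O}_K^d$ and $M(u)$ is the $d\times d$ matrix with $(i,j)$ entry $u_i-u_j$. For a lattice $L\subset K^d$, $\mathrm{End}_{\mathcal{O}_K}(L)=\{X\in K^{d\times d}:XL\subseteq L\}$. $\overline{\oplus}$ denotes entrywise maximum of matrices, and $\underline{\odot}$ the min-plus matrix product $(A\,\underline{\odot}\,B)_{ik}=\min_j(a_{ij}+b_{jk})$. -}

module Defs where

open import Level using (Level; _⊔_) renaming (suc to lsuc)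
open import Data.Nat using (ℕ; zero; suc)
open import Data.Fin using (Fin; zero; suc)
open import Data.Integer using (ℤ; +_; -[1+_]) renaming (_+_ to _+ℤ_; _-_ to _-ℤ_; _⊔_ to _⊔ℤ_; _⊓_ to _⊓ℤ_; _≤_ to _≤ℤ_)
open import Data.Product using (Σ; _×_; _,_; proj₁)
open import Relation.Nullary using (¬_)
open import Relation.Binary.PropositionalEquality using (_≡_)
open import Algebra.Bundles using (CommutativeRing)
import Algebra.Properties.Monoid.Sum as MonoidSum
import Data.Vec.Functional as VF

data ℤ∞ : Set where
  fin : ℤ → ℤ∞
  ∞   : ℤ∞

infix 4 _≤∞_
data _≤∞_ : ℤ∞ → ℤ∞ → Set where
  fin≤fin : ∀ {a b} → a ≤ℤ b → fin a ≤∞ fin b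
  _≤∞∞    : ∀ x → x ≤∞ ∞

_+∞_ : ℤ∞ → ℤ∞ → ℤ∞
fin a +∞ fin b = fin (a +ℤ b)
fin _ +∞ ∞     = ∞
∞     +∞ _     = ∞

min∞ : ℤ∞ → ℤ∞ → ℤ∞
min∞ (fin a) (fin b) = fin (a ⊓ℤ b)
min∞ (fin a) ∞       = fin a
min∞ ∞       y       = y

record DiscretelyValuedField (c ℓ : Level) : Set (lsuc (c ⊔ ℓ)) where
  field
    commRing : CommutativeRing c ℓ
  open CommutativeRing commRing public
  field
    1≉0     : ¬ (1# ≈ 0#)
    inverse : ∀ x → ¬ (x ≈ 0#) → Σ Carrier (λ y → x * y ≈ 1#)
    val      : Carrier → ℤ∞
    val-cong : ∀ {x y} → x ≈ y → val x ≡ val y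
    val-∞⇒0  : ∀ x → val x ≡ ∞ → x ≈ 0#
    val-0    : val 0# ≡ ∞
    val-*    : ∀ x y → val (x * y) ≡ val x +∞ val y
    val-+    : ∀ x y → min∞ (val x) (val y) ≤∞ val (x + y)
    val-surj : ∀ z → Σ Carrier (λ x → val x ≡ fin z)
    p        : Carrier
    val-p    : val p ≡ fin (+ 1)

module DVF {c ℓ} (K : DiscretelyValuedField c ℓ) where
  open DiscretelyValuedField K

  p≉0 : ¬ (p ≈ 0#)
  p≉0 p≈0 with val-cong p≈0
  ... | e rewrite val-p | val-0 with e
  ... | ()

  p⁻¹ : Carrier
  p⁻¹ = proj₁ (inverse p p≉0)

  _^ℕ_ : Carrier → ℕ → Carrier
  x ^ℕ zero  = 1#
  x ^ℕ suc n = x * (x ^ℕ n)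

  p^ : ℤ → Carrier
  p^ (+ n)     = p ^ℕ n
  p^ -[1+ n ]  = p⁻¹ ^ℕ suc n

  InO : Carrier → Set
  InO x = fin (+ 0) ≤∞ val x

  Vec : ℕ → Set c
  Vec d = Fin d → Carrier

  Mat : ℕ → Set c
  Mat d = Fin d → Fin d → Carrier

  open MonoidSum +-monoid using (sum)

  _·_ : ∀ {d} → Mat d → Vec d → Vec d
  (X · v) i = sum (λ j → X i j * v j)

  -- L_u = diag(p^{u_1},…,p^{u_d}) O_K^d
  _∈L_ : ∀ {d} → Vec d → (Fin d → ℤ) → Set (c ⊔ ℓ)
  v ∈L u = Σ (Fin _ → Carrier) (λ w → ((i : Fin _) → InO (w i)) × ((i : Fin _) → v i ≈ p^ (u i) * w i))

  _∈End_ : ∀ {d} → Mat d → (Fin d → ℤ) → Set (c ⊔ ℓ)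
  X ∈End u = ∀ v → v ∈L u → (X · v) ∈L u

  _∈Λ_ : ∀ {d} → Mat d → (Fin d → Fin d → ℤ) → Set
  X ∈Λ M = ∀ i j → fin (M i j) ≤∞ val (X i j)

ZMat : ℕ → Set
ZMat d = Fin d → Fin d → ℤ

Mof : ∀ {d} → (Fin d → ℤ) → ZMat d
Mof u i j = u i -ℤ u j

_⊕̄_ : ∀ {d} → ZMat d → ZMat d → ZMat d
(A ⊕̄ B) i j = A i j ⊔ℤ B i j

bigMax : ∀ {d} n → (Fin (suc n) → ZMat d) → ZMat d
bigMax zero    A = A zero
bigMax (suc n) A = A zero ⊕̄ bigMax n (λ k → A (suc k))

-- The minimum over the (nonempty, since i : Fin d) index set Fin d is
-- computed as a fold seeded with the j = i term, which is itself one of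
-- the terms, so this is exactly min_j.
_⊙_ : ∀ {d} → ZMat d → ZMat d → ZMat d
(A ⊙ B) i k = VF.foldr _⊓ℤ_ (A i i +ℤ B i k) (λ j → A i j +ℤ B j k)

{-# OPTIONS --safe #-}
module Submission where

-- Testing X ∈ End(L_u) on the basis vectors p^{u_j} e_j of L_u shows that X preserves L_u
-- exactly when val(x_ij) ≥ u_i - u_j; conversely these bounds give X L_u ⊆ L_u by the
-- ultrametric inequality. Intersecting over the lattices turns the bounds into their
-- entrywise maximum M. Each M(u) has zero diagonal and satisfies the triangle inequality
-- (with equality), both properties pass to maxima, and a matrix with them is min-plus
-- idempotent since the term j = i of (M ⊙ M)_ik is the minimal one.

open import Defs
open import Data.Nat using (ℕ; suc)
open import Data.Fin using (Fin)
open import Data.Integer using (ℤ; _+_; _≤_)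
open import Data.Product using (_×_)
open import Function.Bundles using (_⇔_)
open import Relation.Binary.PropositionalEquality using (_≡_)

import Data.Nat as ℕ
import Data.Integer.Properties as ℤ
import Data.Fin as Fin
open import Data.Integer using (+_; -[1+_]; -_; _-_; _⊔_; _⊓_; 0ℤ)
open import Data.Integer.Properties
  using ( ≤-refl; ≤-trans; ≤-reflexive; ≤-antisym; i≤i⊔j; i≤j⊔i; ⊔-lub; ⊔-idem; ⊓-glb; i⊓j≤j
        ; +-mono-≤; +-monoˡ-≤
        ; +-minus-telescope; +-0-abelianGroup)
open import Algebra.Bundles using (AbelianGroup)
open import Algebra.Properties.Group (AbelianGroup.group +-0-abelianGroup)
  using (identityʳ-unique; inverseʳ-unique)
open import Data.Product using (_,_; proj₁; proj₂)
open import Data.Empty using (⊥-elim)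
open import Function.Bundles using (mk⇔)
open import Function.Construct.Composition using (_⇔-∘_)
open import Relation.Binary.PropositionalEquality as ≡ using (cong; cong₂; subst)
import Data.Vec.Functional as VF
import Algebra.Properties.Monoid.Sum as MonoidSum
import Algebra.Properties.CommutativeSemigroup as CommutativeSemigroupProperties
import Relation.Binary.Reasoning.Setoid as SetoidReasoning

i-j+j≡i : ∀ i j → i - j + j ≡ i
i-j+j≡i i j =
  ≡.trans (ℤ.+-assoc i (- j) j) (≡.trans (cong (λ k → i + k) (ℤ.+-inverseˡ j)) (ℤ.+-identityʳ i))

fin-injective : ∀ {a b} → fin a ≡ fin b → a ≡ b
fin-injective ≡.refl = ≡.refl

≤∞-trans : ∀ {x y z} → x ≤∞ y → y ≤∞ z → x ≤∞ z
≤∞-trans (fin≤fin p) (fin≤fin q) = fin≤fin (≤-trans p q)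
≤∞-trans _           (_ ≤∞∞)     = _ ≤∞∞

≤∞-respˡ-≡ : ∀ {a b x} → a ≡ b → fin a ≤∞ x → fin b ≤∞ x
≤∞-respˡ-≡ ≡.refl h = h

+∞-mono-≤∞ : ∀ {a b x y} → a ≤∞ x → b ≤∞ y → a +∞ b ≤∞ x +∞ y
+∞-mono-≤∞ (fin≤fin p) (fin≤fin q) = fin≤fin (+-mono-≤ p q)
+∞-mono-≤∞ (fin≤fin p) (_ ≤∞∞)     = _ ≤∞∞
+∞-mono-≤∞ (_ ≤∞∞)     _           = _ ≤∞∞

min∞-glb : ∀ {a x y} → fin a ≤∞ x → fin a ≤∞ y → fin a ≤∞ min∞ x y
min∞-glb (fin≤fin p) (fin≤fin q) = fin≤fin (⊓-glb p q)
min∞-glb (fin≤fin p) (_ ≤∞∞)     = fin≤fin p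
min∞-glb (_ ≤∞∞)     q           = q

fin≤∞fin+∞nonneg : ∀ a {y} → fin 0ℤ ≤∞ y → fin a ≤∞ fin a +∞ y
fin≤∞fin+∞nonneg a (fin≤fin 0≤y) =
  fin≤fin (≤-trans (≤-reflexive (≡.sym (ℤ.+-identityʳ a))) (+-mono-≤ (≤-refl {a}) 0≤y))
fin≤∞fin+∞nonneg a (_ ≤∞∞) = _ ≤∞∞

+∞-finʳ-cancel : ∀ {a b} x → fin a ≤∞ x +∞ fin b → fin (a - b) ≤∞ x
+∞-finʳ-cancel ∞ _ = _ ≤∞∞
+∞-finʳ-cancel {a} {b} (fin x) (fin≤fin a≤x+b) = fin≤fin (begin
  a - b         ≤⟨ +-monoˡ-≤ (- b) a≤x+b ⟩
  x + b - b     ≡⟨ ℤ.+-assoc x b (- b) ⟩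
  x + (b - b)   ≡⟨ cong (λ y → x + y) (ℤ.+-inverseʳ b) ⟩
  x + 0ℤ        ≡⟨ ℤ.+-identityʳ x ⟩
  x             ∎)
  where open ℤ.≤-Reasoning

module _ {d : ℕ} where

  bigMax-upper : ∀ n (A : Fin (suc n) → ZMat d) k i j → A k i j ≤ bigMax n A i j
  bigMax-upper ℕ.zero    A Fin.zero    i j = ≤-refl
  bigMax-upper (ℕ.suc n) A Fin.zero    i j = i≤i⊔j _ _
  bigMax-upper (ℕ.suc n) A (Fin.suc k) i j =
    ≤-trans (bigMax-upper n (λ k → A (Fin.suc k)) k i j) (i≤j⊔i _ _)

  bigMax-least : ∀ n (A : Fin (suc n) → ZMat d) {i j c} →
                 (∀ k → A k i j ≤ c) → bigMax n A i j ≤ c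
  bigMax-least ℕ.zero    A h = h Fin.zero
  bigMax-least (ℕ.suc n) A h =
    ⊔-lub (h Fin.zero) (bigMax-least n (λ k → A (Fin.suc k)) (λ k → h (Fin.suc k)))

  bigMax-least∞ : ∀ n (A : Fin (suc n) → ZMat d) {i j} x →
                  (∀ k → fin (A k i j) ≤∞ x) → fin (bigMax n A i j) ≤∞ x
  bigMax-least∞ n A ∞       h = _ ≤∞∞
  bigMax-least∞ n A (fin x) h = fin≤fin (bigMax-least n A (λ k → fin-inv (h k)))
    where
    fin-inv : ∀ {a b} → fin a ≤∞ fin b → a ≤ b
    fin-inv (fin≤fin a≤b) = a≤b

  HasZeroDiagonal : ZMat d → Set
  HasZeroDiagonal M = ∀ i → M i i ≡ 0ℤ

  IsTriangular : ZMat d → Set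
  IsTriangular M = ∀ i j k → M i k ≤ M i j + M j k

  Mof-zeroDiagonal : ∀ u → HasZeroDiagonal (Mof u)
  Mof-zeroDiagonal u i = ℤ.+-inverseʳ (u i)

  Mof-triangular : ∀ u → IsTriangular (Mof u)
  Mof-triangular u i j k = ≤-reflexive (≡.sym (+-minus-telescope (u i) (u j) (u k)))

  bigMax-zeroDiagonal : ∀ n (A : Fin (suc n) → ZMat d) →
                        (∀ k → HasZeroDiagonal (A k)) → HasZeroDiagonal (bigMax n A)
  bigMax-zeroDiagonal ℕ.zero    A h i = h Fin.zero i
  bigMax-zeroDiagonal (ℕ.suc n) A h i =
    ≡.trans (cong₂ _⊔_ (h Fin.zero i) (bigMax-zeroDiagonal n (λ k → A (Fin.suc k)) (λ k → h (Fin.suc k)) i))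
            (⊔-idem 0ℤ)

  bigMax-triangular : ∀ n (A : Fin (suc n) → ZMat d) →
                      (∀ k → IsTriangular (A k)) → IsTriangular (bigMax n A)
  bigMax-triangular n A h i j k = bigMax-least n A λ l →
    ≤-trans (h l i j k) (+-mono-≤ (bigMax-upper n A l i j) (bigMax-upper n A l j k))

  foldr-⊓-least-seed : ∀ {m} s (f : Fin m → ℤ) → (∀ j → s ≤ f j) → VF.foldr _⊓_ s f ≡ s
  foldr-⊓-least-seed {ℕ.zero}  s f h = ≡.refl
  foldr-⊓-least-seed {ℕ.suc m} s f h =
    ≡.trans (cong (f Fin.zero ⊓_) (foldr-⊓-least-seed s (λ j → f (Fin.suc j)) (λ j → h (Fin.suc j))))
            (≤-antisym (i⊓j≤j _ _) (⊓-glb (h Fin.zero) ≤-refl))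

  ⊙-idempotent : ∀ {M} → HasZeroDiagonal M → IsTriangular M → ∀ i k → (M ⊙ M) i k ≡ M i k
  ⊙-idempotent {M} diag tri i k =
    ≡.trans (foldr-⊓-least-seed (M i i + M i k) (λ j → M i j + M j k)
                                (λ j → ≤-trans (≤-reflexive seed≡Mik) (tri i j k)))
            seed≡Mik
    where
    seed≡Mik : M i i + M i k ≡ M i k
    seed≡Mik = ≡.trans (cong (_+ M i k) (diag i)) (ℤ.+-identityˡ (M i k))

module _ {c ℓ} (K : DiscretelyValuedField c ℓ) where
  open DiscretelyValuedField K
    renaming (_+_ to _+ᴷ_; _*_ to _*ᴷ_; -_ to -ᴷ_; _-_ to _-ᴷ_)
  open DVF K
  open MonoidSum +-monoid using (sum; sum-cong-≋; sum-replicate-zero)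
  open CommutativeSemigroupProperties *-commutativeSemigroup using (interchange)
  open SetoidReasoning setoid

  p*p⁻¹≈1 : p *ᴷ p⁻¹ ≈ 1#
  p*p⁻¹≈1 = proj₂ (inverse p p≉0)

  val-1 : val 1# ≡ fin 0ℤ
  val-1 with val 1# in eq | ≡.trans (val-cong (sym (*-identityˡ 1#))) (val-* 1# 1#)
  ... | fin a | a≡a+a = cong fin (identityʳ-unique a a (≡.sym (fin-injective a≡a+a)))
  ... | ∞     | _     = ⊥-elim (1≉0 (val-∞⇒0 1# eq))

  val-p⁻¹ : val p⁻¹ ≡ fin -[1+ 0 ]
  val-p⁻¹ with val p⁻¹ | ≡.trans (≡.sym (val-* p p⁻¹)) (≡.trans (val-cong p*p⁻¹≈1) val-1)
  ... | fin b | e rewrite val-p = cong fin (inverseʳ-unique (+ 1) b (fin-injective e))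
  ... | ∞     | e rewrite val-p with e
  ...   | ()

  val-p^ℕ : ∀ n → val (p ^ℕ n) ≡ fin (+ n)
  val-p^ℕ ℕ.zero = val-1
  val-p^ℕ (ℕ.suc n) rewrite val-* p (p ^ℕ n) | val-p | val-p^ℕ n = ≡.refl

  val-p⁻¹^ℕ : ∀ n → val (p⁻¹ ^ℕ suc n) ≡ fin -[1+ n ]
  val-p⁻¹^ℕ ℕ.zero rewrite val-* p⁻¹ 1# | val-p⁻¹ | val-1 = ≡.refl
  val-p⁻¹^ℕ (ℕ.suc n) rewrite val-* p⁻¹ (p⁻¹ ^ℕ suc n) | val-p⁻¹ | val-p⁻¹^ℕ n = ≡.refl

  val-p^ : ∀ z → val (p^ z) ≡ fin z
  val-p^ (+ n)    = val-p^ℕ n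
  val-p^ -[1+ n ] = val-p⁻¹^ℕ n

  val-p^-* : ∀ z x → val (p^ z *ᴷ x) ≡ fin z +∞ val x
  val-p^-* z x = ≡.trans (val-* (p^ z) x) (cong (_+∞ val x) (val-p^ z))

  val-*-p^ : ∀ x z → val (x *ᴷ p^ z) ≡ val x +∞ fin z
  val-*-p^ x z = ≡.trans (val-* x (p^ z)) (cong (val x +∞_) (val-p^ z))

  ^ℕ-inverse : ∀ {x y} → x *ᴷ y ≈ 1# → ∀ n → (x ^ℕ n) *ᴷ (y ^ℕ n) ≈ 1#
  ^ℕ-inverse xy≈1 ℕ.zero = *-identityˡ 1#
  ^ℕ-inverse {x} {y} xy≈1 (ℕ.suc n) = begin
    (x *ᴷ (x ^ℕ n)) *ᴷ (y *ᴷ (y ^ℕ n)) ≈⟨ interchange x (x ^ℕ n) y (y ^ℕ n) ⟩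
    (x *ᴷ y) *ᴷ ((x ^ℕ n) *ᴷ (y ^ℕ n)) ≈⟨ *-cong xy≈1 (^ℕ-inverse xy≈1 n) ⟩
    1# *ᴷ 1#                           ≈⟨ *-identityˡ 1# ⟩
    1#                                 ∎

  p^-inverse : ∀ z → p^ z *ᴷ p^ (- z) ≈ 1#
  p^-inverse (+ ℕ.zero)  = *-identityˡ 1#
  p^-inverse (+ ℕ.suc n) = ^ℕ-inverse p*p⁻¹≈1 (suc n)
  p^-inverse -[1+ n ]    = trans (*-comm _ _) (^ℕ-inverse p*p⁻¹≈1 (suc n))

  val-sum-≥ : ∀ {m} a (f : Fin m → Carrier) → (∀ j → fin a ≤∞ val (f j)) → fin a ≤∞ val (sum f)
  val-sum-≥ {ℕ.zero} a f h rewrite val-0 = _ ≤∞∞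
  val-sum-≥ {ℕ.suc m} a f h =
    ≤∞-trans (min∞-glb (h Fin.zero) (val-sum-≥ a (λ j → f (Fin.suc j)) (λ j → h (Fin.suc j))))
             (val-+ _ _)

  δ : ∀ {m} → Fin m → Fin m → Carrier
  δ Fin.zero    Fin.zero    = 1#
  δ Fin.zero    (Fin.suc _) = 0#
  δ (Fin.suc _) Fin.zero    = 0#
  δ (Fin.suc i) (Fin.suc j) = δ i j

  δ∈O : ∀ {m} (j l : Fin m) → InO (δ j l)
  δ∈O Fin.zero    Fin.zero    rewrite val-1 = fin≤fin ≤-refl
  δ∈O Fin.zero    (Fin.suc l) rewrite val-0 = _ ≤∞∞
  δ∈O (Fin.suc j) Fin.zero    rewrite val-0 = _ ≤∞∞
  δ∈O (Fin.suc j) (Fin.suc l) = δ∈O j l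

  sum-≈0 : ∀ {m} {f : Fin m → Carrier} → (∀ l → f l ≈ 0#) → sum f ≈ 0#
  sum-≈0 {m} {f} f≈0 = trans (sum-cong-≋ {x = f} {y = VF.replicate m 0#} f≈0) (sum-replicate-zero m)

  sum-*δ : ∀ {m} (g : Fin m → Carrier) j → sum (λ l → g l *ᴷ δ j l) ≈ g j
  sum-*δ {ℕ.suc m} g Fin.zero = begin
    g Fin.zero *ᴷ 1# +ᴷ sum (λ l → g (Fin.suc l) *ᴷ 0#)
      ≈⟨ +-cong (*-identityʳ _) (sum-≈0 (λ l → zeroʳ (g (Fin.suc l)))) ⟩
    g Fin.zero +ᴷ 0#                                   ≈⟨ +-identityʳ _ ⟩
    g Fin.zero                                         ∎
  sum-*δ {ℕ.suc m} g (Fin.suc j) = trans (+-cong (zeroʳ _) (sum-*δ (λ l → g (Fin.suc l)) j)) (+-identityˡ _)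

  ∈L⇒val-≥ : ∀ {m} {v : Vec m} {u} → v ∈L u → ∀ j → fin (u j) ≤∞ val (v j)
  ∈L⇒val-≥ {u = u} (w , w∈O , v≈p^w) j rewrite val-cong (v≈p^w j) | val-p^-* (u j) (w j) =
    fin≤∞fin+∞nonneg (u j) (w∈O j)

  ∈Λ-Mof⇒∈End : ∀ {m} (u : Fin m → ℤ) X → X ∈Λ Mof u → X ∈End u
  ∈Λ-Mof⇒∈End u X X∈Λ v v∈L = (λ i → p^ (- u i) *ᴷ (X · v) i) , coords∈O , Xv≈p^coords
    where
    Xv≈p^coords : ∀ i → (X · v) i ≈ p^ (u i) *ᴷ (p^ (- u i) *ᴷ (X · v) i)
    Xv≈p^coords i = sym (begin
      p^ (u i) *ᴷ (p^ (- u i) *ᴷ (X · v) i) ≈⟨ sym (*-assoc _ _ _) ⟩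
      (p^ (u i) *ᴷ p^ (- u i)) *ᴷ (X · v) i ≈⟨ *-congʳ (p^-inverse (u i)) ⟩
      1# *ᴷ (X · v) i                       ≈⟨ *-identityˡ _ ⟩
      (X · v) i                             ∎)
    term-≥ : ∀ i j → fin (u i) ≤∞ val (X i j *ᴷ v j)
    term-≥ i j rewrite val-* (X i j) (v j) =
      ≤∞-respˡ-≡ (i-j+j≡i (u i) (u j)) (+∞-mono-≤∞ (X∈Λ i j) (∈L⇒val-≥ {u = u} v∈L j))
    coords∈O : ∀ i → InO (p^ (- u i) *ᴷ (X · v) i)
    coords∈O i rewrite val-p^-* (- u i) ((X · v) i) =
      ≤∞-respˡ-≡ (ℤ.+-inverseˡ (u i)) (+∞-mono-≤∞ (fin≤fin ≤-refl) (val-sum-≥ (u i) _ (term-≥ i)))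

  ∈End⇒∈Λ-Mof : ∀ {m} (u : Fin m → ℤ) X → X ∈End u → X ∈Λ Mof u
  ∈End⇒∈Λ-Mof u X X∈End i j = +∞-finʳ-cancel (val (X i j)) val-≥
    where
    basis : Vec _
    basis l = p^ (u l) *ᴷ δ j l
    image : (X · basis) ∈L u
    image = X∈End basis (δ j , δ∈O j , λ l → refl)
    w : Vec _
    w = proj₁ image
    Xbasis≈Xij*p^ : (X · basis) i ≈ X i j *ᴷ p^ (u j)
    Xbasis≈Xij*p^ = trans (sum-cong-≋ (λ l → sym (*-assoc (X i l) (p^ (u l)) (δ j l))))
                          (sum-*δ (λ l → X i l *ᴷ p^ (u l)) j)
    val-eq : val (X i j) +∞ fin (u j) ≡ fin (u i) +∞ val (w i)
    val-eq = ≡.trans (≡.sym (val-*-p^ (X i j) (u j)))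
             (≡.trans (val-cong (trans (sym Xbasis≈Xij*p^) (proj₂ (proj₂ image) i)))
                      (val-p^-* (u i) (w i)))
    val-≥ : fin (u i) ≤∞ val (X i j) +∞ fin (u j)
    val-≥ = subst (fin (u i) ≤∞_) (≡.sym val-eq) (fin≤∞fin+∞nonneg (u i) (proj₁ (proj₂ image) i))

  ∈Λ-bigMax⇔ : ∀ {m} n (A : Fin (suc n) → ZMat m) X → (∀ k → X ∈Λ A k) ⇔ X ∈Λ bigMax n A
  ∈Λ-bigMax⇔ n A X = mk⇔
    (λ X∈Λ i j → bigMax-least∞ n A (val (X i j)) (λ k → X∈Λ k i j))
    (λ X∈Λ k i j → ≤∞-trans (fin≤fin (bigMax-upper n A k i j)) (X∈Λ i j))

  PZ⇔Λ : ∀ {m} n (u : Fin (suc n) → Fin m → ℤ) X →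
          (∀ k → X ∈End u k) ⇔ X ∈Λ bigMax n (λ k → Mof (u k))
  PZ⇔Λ n u X = ∈Λ-bigMax⇔ n (λ k → Mof (u k)) X ⇔-∘ mk⇔
    (λ X∈End k → ∈End⇒∈Λ-Mof (u k) X (X∈End k))
    (λ X∈Λ k → ∈Λ-Mof⇒∈End (u k) X (X∈Λ k))

theorem3p3 : ∀ {c ℓ} (K : DiscretelyValuedField c ℓ) (d n : ℕ)
             (u : Fin (suc n) → Fin d → ℤ) →
             let open DVF K
                 M = bigMax n (λ k → Mof (u k))
             in ((X : Mat d) → ((k : Fin (suc n)) → X ∈End (u k)) ⇔ X ∈Λ M)
                × ((i j k : Fin d) → M i k ≤ M i j + M j k)
                × ((i k : Fin d) → (M ⊙ M) i k ≡ M i k)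
theorem3p3 K d n u = PZ⇔Λ K n u , triangular , ⊙-idempotent diagonal triangular
  where
  A : Fin (suc n) → ZMat d
  A k = Mof (u k)
  triangular : IsTriangular (bigMax n A)
  triangular = bigMax-triangular n A (λ k → Mof-triangular (u k))
  diagonal : HasZeroDiagonal (bigMax n A)
  diagonal = bigMax-zeroDiagonal n A (λ k → Mof-zeroDiagonal (u k))
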